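{- Let $F$ be a set of unary functions on a finite domain $D$. There exists a set of functions $G\subseteq F$ such that $\operatorname{Cor}\Gamma_F=\Gamma_G$.
   Context: The graph of $f$ is $\Gamma_f=\{(x,f(x))\mid x\in D\}$ and $\Gamma_F=\{\Gamma_f\mid f\in F\}$. A unary operation $p$ is a polymorphism of a relation $R$ if applying $p$ coordinate-wise to any tuple of $R$ yields a tuple of $R$. The core $\operatorname{Cor} S$ of a set $S$ of relations is $p(S)=\{p(R)\mid R\in S\}$ where $p$ is a unary polymorphism of every relation in $S$ with smallest range among such polymorphisms and $p(R)$ is the coordinate-wise image of $R$ under $p$; it is unique up to renaming, and every unary polymorphism of a core is a permutation. -}

module Defs where

open import Level using (Lift)
open import Data.Nat using (ℕ; _≤_)
open import Data.Fin using (Fin)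
open import Data.Fin.Properties using (any?) renaming (_≟_ to _≟F_)
open import Data.List using (List; length; filter; allFin)
open import Data.Product using (Σ; ∃; _×_; _,_)
open import Relation.Binary.PropositionalEquality using (_≡_)
open import Function.Bundles using (_⇔_)

-- The finite domain D is modelled as Fin n.
-- A unary function on D.
Fun : ℕ → Set
Fun n = Fin n → Fin n

FunSet : ℕ → Set₁
FunSet n = Fun n → Set

Rel₂ : ℕ → Set₁
Rel₂ n = Fin n → Fin n → Set

_≐_ : ∀ {n} → Rel₂ n → Rel₂ n → Set
R ≐ R' = ∀ x y → R x y ⇔ R' x y

RelSet : ℕ → Set₂
RelSet n = Rel₂ n → Set₁

_≐ₛ_ : ∀ {n} → RelSet n → RelSet n → Set₁
S ≐ₛ T = ∀ R → (S R → T R) × (T R → S R)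

_⊆F_ : ∀ {n} → FunSet n → FunSet n → Set
G ⊆F F = ∀ g → G g → F g

graph : ∀ {n} → Fun n → Rel₂ n
graph f x y = f x ≡ y

-- Γ_F = {Γ_f | f ∈ F}  (membership up to extensional equality of relations).
Γ : ∀ {n} → FunSet n → RelSet n
Γ F R = Lift _ (Σ (Fun _) λ f → F f × (R ≐ graph f))

Pol : ∀ {n} → Fun n → Rel₂ n → Set
Pol p R = ∀ x y → R x y → R (p x) (p y)

PolSet : ∀ {n} → Fun n → RelSet n → Set₁
PolSet p S = ∀ R → S R → Pol p R

rangeSize : ∀ {n} → Fun n → ℕ
rangeSize {n} p = length (filter (λ y → any? (λ x → p x ≟F y)) (allFin n))

IsCoreMap : ∀ {n} → RelSet n → Fun n → Set₁
IsCoreMap S p = PolSet p S × (∀ q → PolSet q S → rangeSize p ≤ rangeSize q)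

imageRel : ∀ {n} → Fun n → Rel₂ n → Rel₂ n
imageRel p R x' y' = ∃ λ x → ∃ λ y → R x y × (p x ≡ x') × (p y ≡ y')

imageSet : ∀ {n} → Fun n → RelSet n → RelSet n
imageSet p S R' = Σ (Rel₂ _) λ R → S R × (R' ≐ imageRel p R)

InRange : ∀ {n} → Fun n → Fin n → Set
InRange p y = ∃ λ x → p x ≡ y

graphOn : ∀ {n} → (Fin n → Set) → Fun n → Rel₂ n
graphOn D' g x y = D' x × (g x ≡ y)

ΓOn : ∀ {n} → (Fin n → Set) → FunSet n → RelSet n
ΓOn D' G R = Lift _ (Σ (Fun _) λ g → G g × (R ≐ graphOn D' g))

module Submission where

-- Let p be a unary polymorphism of every graph Γ_f with
-- f ∈ F.  Preserving Γ_f means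
-- exactly that p commutes with f:  f (p x) = p (f x).  Consequently the image
-- p(Γ_f) = {(p x, p (f x))} = {(p x, f (p x))} is the graph of f restricted to
-- the range D' of p.  Hence the core p(Γ_F) consists precisely of the graphs
-- over D' of the functions of F itself, so G = F witnesses the theorem.

open import Defs
open import Data.Nat using (ℕ)
open import Data.Product using (Σ; _×_; _,_)
open import Level using (lift)
open import Function.Bundles using (mk⇔; Equivalence)
open import Function.Properties.Equivalence using (⇔-isEquivalence)
open import Relation.Binary.Structures using (IsEquivalence)
open import Relation.Binary.PropositionalEquality using (_≡_; refl; sym; cong; module ≡-Reasoning)

open Equivalence using (to; from)
private
  module ⇔ {ℓ} = IsEquivalence (⇔-isEquivalence {ℓ})

≐-refl : ∀ {n} {R : Rel₂ n} → R ≐ R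
≐-refl x y = ⇔.refl

≐-sym : ∀ {n} {R S : Rel₂ n} → R ≐ S → S ≐ R
≐-sym R≐S x y = ⇔.sym (R≐S x y)

≐-trans : ∀ {n} {R S T : Rel₂ n} → R ≐ S → S ≐ T → R ≐ T
≐-trans R≐S S≐T x y = ⇔.trans (R≐S x y) (S≐T x y)

-- The coordinate-wise image p(R) depends only on R up to ≐; needed because
-- membership in Γ_F only determines a relation up to ≐.
imageRel-cong : ∀ {n} (p : Fun n) {R S : Rel₂ n} → R ≐ S → imageRel p R ≐ imageRel p S
imageRel-cong p R≐S x' y' = mk⇔
  (λ { (x , y , r , px , py) → x , y , to (R≐S x y) r , px , py })
  (λ { (x , y , s , px , py) → x , y , from (R≐S x y) s , px , py })

polymorphism-commutes : ∀ {n} {p f : Fun n} → Pol p (graph f) → ∀ x → f (p x) ≡ p (f x)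
polymorphism-commutes pol x = pol x _ refl

image-of-graph : ∀ {n} {p f : Fun n} → (∀ x → f (p x) ≡ p (f x)) →
                 imageRel p (graph f) ≐ graphOn (InRange p) f
image-of-graph {p = p} {f} commutes x' y' = mk⇔ image⇒graph graph⇒image
  where
  open ≡-Reasoning

  image⇒graph : imageRel p (graph f) x' y' → graphOn (InRange p) f x' y'
  image⇒graph (x , y , fx≡y , px≡x' , py≡y') = (x , px≡x') , (begin
    f x'      ≡⟨ cong f (sym px≡x') ⟩
    f (p x)   ≡⟨ commutes x ⟩
    p (f x)   ≡⟨ cong p fx≡y ⟩
    p y       ≡⟨ py≡y' ⟩
    y'        ∎)

  graph⇒image : graphOn (InRange p) f x' y' → imageRel p (graph f) x' y'
  graph⇒image ((x , px≡x') , fx'≡y') = x , f x , refl , px≡x' , (begin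
    p (f x)   ≡⟨ sym (commutes x) ⟩
    f (p x)   ≡⟨ cong f px≡x' ⟩
    f x'      ≡⟨ fx'≡y' ⟩
    y'        ∎)

lemma1 : (n : ℕ) (F : FunSet n) (p : Fun n) → IsCoreMap (Γ F) p →
           Σ (FunSet n) λ G → (G ⊆F F) × (imageSet p (Γ F) ≐ₛ ΓOn (InRange p) G)
lemma1 n F p (pol , _) = F , (λ _ Ff → Ff) , λ R' → core⇒graphs R' , graphs⇒core R'
  where
  image-of-member : ∀ f → F f → imageRel p (graph f) ≐ graphOn (InRange p) f
  image-of-member f Ff =
    image-of-graph (polymorphism-commutes (pol (graph f) (lift (f , Ff , ≐-refl))))

  core⇒graphs : ∀ R' → imageSet p (Γ F) R' → ΓOn (InRange p) F R'
  core⇒graphs R' (R , lift (f , Ff , R≐Γf) , R'≐pR) =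
    lift (f , Ff , ≐-trans R'≐pR (≐-trans (imageRel-cong p R≐Γf) (image-of-member f Ff)))

  graphs⇒core : ∀ R' → ΓOn (InRange p) F R' → imageSet p (Γ F) R'
  graphs⇒core R' (lift (f , Ff , R'≐graphOn)) =
    graph f , lift (f , Ff , ≐-refl) , ≐-trans R'≐graphOn (≐-sym (image-of-member f Ff))
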